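{- Let an instance of the ordered unrelated machines scheduling problem be given by $c$ machines, $n$ jobs and running times $T(i,j)$, and let $M>0$ and $\delta>0$. Construct the following instance of the joint cache partition and job assignment problem with integral cache allocations: $c$ cores, total cache $K=c(c+1)/2$, and $n+c$ jobs. For $1\le j\le n$, job $j$ has load function $T_j(x)=T(x,j)$ for integers $1\le x\le c$, $T_j(x)=T(c,j)$ for $x>c$, and $T_j(0)=T(1,j)$. For $n+1\le j\le n+c$, job $j$ has $T_j(x)=M+\delta$ if $x\ge j-n$ and $T_j(x)=\infty$ if $x<j-n$. Then the constructed instance has a solution of makespan at most $2M+\delta$ if and only if the original ordered unrelated machines instance has a schedule of makespan at most $M$.
   Context: Ordered unrelated machines scheduling: $c$ machines $1,\dots,c$, $n$ jobs, running times $T(i,j)>0$ with $T(i_1,j)\ge T(i_2,j)$ whenever $i_1<i_2$; a schedule assigns each job to a machine and its makespan is the maximum total running time on a machine. Joint cache partition and job assignment problem (integral version): given $c$ cores, total cache $K$ and jobs $j$ with non-increasing load functions $T_j:\{0,1,2,\dots\}\to(0,\infty]$, a solution is a cache partition $p:\{1,\dots,c\}\to\{0,1,2,\dots\}$ with $\sum_i p(i)\le K$ and an assignment $S$ of jobs to cores; its makespan is $\max_i\sum_{j:S(j)=i}T_j(p(i))$.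
   Formalization: The running times T(i,j) and the parameters M and δ are rational, so the load functions of the constructed instance take values in the rationals together with ∞. -}

module Defs where

open import Data.Nat using (ℕ; zero; suc; _⊓_; _∸_; s≤s; NonZero) renaming (_≤_ to _≤ℕ_)
open import Data.Nat.Properties using (m⊓n≤m)
open import Data.Fin using (Fin; zero; suc; toℕ; fromℕ<; splitAt; _≟_) renaming (_<_ to _<ᶠ_)
open import Data.Sum using (_⊎_; inj₁; inj₂)
open import Data.Product using (Σ; _×_)
open import Data.Bool using (if_then_else_)
open import Relation.Nullary using (does)
open import Data.Rational using (ℚ; 0ℚ; _+_; _≤_; _<_)

data ℚ∞ : Set where
  fin : ℚ → ℚ∞
  ∞   : ℚ∞

_+∞_ : ℚ∞ → ℚ∞ → ℚ∞
fin a +∞ fin b = fin (a + b)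
fin a +∞ ∞     = ∞
∞     +∞ _     = ∞

data _≤∞_ : ℚ∞ → ℚ∞ → Set where
  fin≤fin : ∀ {a b} → a ≤ b → fin a ≤∞ fin b
  _≤∞∞    : ∀ x → x ≤∞ ∞

sumℚ : (n : ℕ) → (Fin n → ℚ) → ℚ
sumℚ zero    f = 0ℚ
sumℚ (suc n) f = f zero + sumℚ n (λ j → f (suc j))

sumℚ∞ : (n : ℕ) → (Fin n → ℚ∞) → ℚ∞
sumℚ∞ zero    f = fin 0ℚ
sumℚ∞ (suc n) f = f zero +∞ sumℚ∞ n (λ j → f (suc j))

sumℕ : (n : ℕ) → (Fin n → ℕ) → ℕ
sumℕ zero    f = 0
sumℕ (suc n) f = f zero Data.Nat.+ sumℕ n (λ j → f (suc j))

-- Ordered unrelated machines scheduling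
-- Machine i ∈ Fin c stands for machine (toℕ i + 1); job j ∈ Fin n for job (toℕ j + 1).

IsOrderedInstance : (c n : ℕ) → (Fin c → Fin n → ℚ) → Set
IsOrderedInstance c n T =
  (∀ i j → 0ℚ < T i j) ×
  (∀ i₁ i₂ j → i₁ <ᶠ i₂ → T i₂ j ≤ T i₁ j)

machineLoad : (c n : ℕ) → (Fin c → Fin n → ℚ) → (Fin n → Fin c) → Fin c → ℚ
machineLoad c n T S i = sumℚ n (λ j → if does (S j ≟ i) then T i j else 0ℚ)

HasScheduleWithin : (c n : ℕ) → (Fin c → Fin n → ℚ) → ℚ → Set
HasScheduleWithin c n T M =
  Σ (Fin n → Fin c) λ S → ∀ i → machineLoad c n T S i ≤ M

coreLoad : (c m : ℕ) → (Fin m → ℕ → ℚ∞) → (Fin c → ℕ) → (Fin m → Fin c) → Fin c → ℚ∞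
coreLoad c m L p S i = sumℚ∞ m (λ j → if does (S j ≟ i) then L j (p i) else fin 0ℚ)

HasJointSolutionWithin : (c K m : ℕ) → (Fin m → ℕ → ℚ∞) → ℚ → Set
HasJointSolutionWithin c K m L B =
  Σ (Fin c → ℕ) λ p → Σ (Fin m → Fin c) λ S →
    (sumℕ c p ≤ℕ K) × (∀ i → coreLoad c m L p S i ≤∞ fin B)

-- index in Fin (suc k) of machine min(max(x,1), suc k), shifted down by one
clampFin : (k : ℕ) → ℕ → Fin (suc k)
clampFin k x = fromℕ< {k ⊓ (x ∸ 1)} (s≤s (m⊓n≤m k (x ∸ 1)))

-- load functions of the constructed instance; c = suc k machines/cores, n + c jobs
-- jobs inj₁ j (j < n): T_j(x) = T(clamp x, j)
-- jobs inj₂ r  (job number n + toℕ r + 1): M+δ if x ≥ toℕ r + 1, ∞ otherwise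
reductionLoads : (k n : ℕ) → (Fin (suc k) → Fin n → ℚ) → ℚ → ℚ →
                 Fin (n Data.Nat.+ suc k) → ℕ → ℚ∞
reductionLoads k n T M δ j x with splitAt n j
... | inj₁ j' = fin (T (clampFin k x) j')
... | inj₂ r  = if does (suc (toℕ r) Data.Nat.≤? x) then fin (M + δ) else ∞

-- Two of the jobs n + r on one
-- core already exceed 2M + δ, so they sit on distinct cores, the one of job n + r having
-- cache at least r.  As the budget c(c+1)/2 is exactly Σ r, that core gets cache exactly r:
-- it behaves like machine r and has room M left for original jobs.  Conversely, from a
-- schedule of makespan M give core i cache i and job n + i.
module Submission where

open import Defs
open import Data.Nat using (ℕ; suc; _*_; _/_)
open import Data.Fin using (Fin)
open import Data.Rational using (ℚ; 0ℚ; _+_; _<_)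
open import Function.Bundles using (_⇔_; mk⇔)

import Algebra.Properties.CommutativeMonoid.Sum as CommutativeMonoidSum
import Algebra.Properties.CommutativeSemigroup as CommutativeSemigroupProperties
open import Data.Bool using (Bool; true; false; if_then_else_)
open import Data.Bool.Properties using (if-float; if-cong; if-cong-then)
open import Data.Fin using (zero; suc; toℕ; _↑ˡ_; _↑ʳ_; splitAt; _≟_; punchOut)
open import Data.Fin.Permutation using (Permutation′; permutation; _⟨$⟩ʳ_; _⟨$⟩ˡ_; inverseˡ; inverseʳ)
open import Data.Fin.Properties
  using ( any?; injective⇒≤; punchOut-injective; splitAt-↑ˡ; splitAt-↑ʳ
        ; toℕ-injective; toℕ-fromℕ<; toℕ≤pred[n])
open import Data.Nat using (zero; z≤n; _≤?_) renaming (_≤_ to _≤ℕ_; _+_ to _+ℕ_)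
import Data.Nat.Properties as ℕ
open import Data.Nat.DivMod using (m*n/n≡m)
open import Data.Product using (∃; _,_; proj₁; proj₂)
open import Data.Rational using (_≤_)
import Data.Rational.Properties as ℚ
open import Data.Rational.Solver using (module +-*-Solver)
open import Data.Sum using ([_,_])
open import Function using (_∘_; id)
open import Function.Definitions using (Injective)
open import Relation.Binary.PropositionalEquality hiding ([_])
open import Relation.Nullary using (Dec; does; yes; no; contradiction)
open import Relation.Nullary.Decidable using (dec-true; does-⇔)

ℚ-+-cancelʳ-≤ : ∀ r {p q} → p + r ≤ q + r → p ≤ q
ℚ-+-cancelʳ-≤ r {p} {q} p+r≤q+r with p ℚ.≤? q
... | yes p≤q = p≤q
... | no  p≰q = contradiction (ℚ.<-≤-trans (ℚ.+-monoˡ-< r (ℚ.≰⇒> p≰q)) p+r≤q+r) (ℚ.<-irrefl refl)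

+∞-identityˡ : ∀ x → fin 0ℚ +∞ x ≡ x
+∞-identityˡ (fin a) = cong fin (ℚ.+-identityˡ a)
+∞-identityˡ ∞       = refl

+∞-identityʳ : ∀ x → x +∞ fin 0ℚ ≡ x
+∞-identityʳ (fin a) = cong fin (ℚ.+-identityʳ a)
+∞-identityʳ ∞       = refl

+∞-assoc : ∀ x y z → (x +∞ y) +∞ z ≡ x +∞ (y +∞ z)
+∞-assoc (fin a) (fin b) (fin c) = cong fin (ℚ.+-assoc a b c)
+∞-assoc (fin a) (fin b) ∞       = refl
+∞-assoc (fin a) ∞       z       = refl
+∞-assoc ∞       y       z       = refl

+∞-comm : ∀ x y → x +∞ y ≡ y +∞ x
+∞-comm (fin a) (fin b) = cong fin (ℚ.+-comm a b)
+∞-comm (fin a) ∞       = refl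
+∞-comm ∞       (fin b) = refl
+∞-comm ∞       ∞       = refl

≤∞-refl : ∀ {x} → x ≤∞ x
≤∞-refl {fin a} = fin≤fin ℚ.≤-refl
≤∞-refl {∞}     = ∞ ≤∞∞

≤∞-trans : ∀ {x y z} → x ≤∞ y → y ≤∞ z → x ≤∞ z
≤∞-trans (fin≤fin a≤b) (fin≤fin b≤c) = fin≤fin (ℚ.≤-trans a≤b b≤c)
≤∞-trans _             (_ ≤∞∞)       = _ ≤∞∞

fin≤fin⁻¹ : ∀ {a b} → fin a ≤∞ fin b → a ≤ b
fin≤fin⁻¹ (fin≤fin a≤b) = a≤b

+∞-mono-≤∞ : ∀ {x x′ y y′} → x ≤∞ x′ → y ≤∞ y′ → (x +∞ y) ≤∞ (x′ +∞ y′)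
+∞-mono-≤∞ (fin≤fin a≤b) (fin≤fin c≤d)     = fin≤fin (ℚ.+-mono-≤ a≤b c≤d)
+∞-mono-≤∞ {x} {y = y} (_ ≤∞∞)     _       = (x +∞ y) ≤∞∞
+∞-mono-≤∞ {x} {y = y} (fin≤fin _) (_ ≤∞∞) = (x +∞ y) ≤∞∞

+∞-monoʳ-≤∞ : ∀ x {y y′} → y ≤∞ y′ → (x +∞ y) ≤∞ (x +∞ y′)
+∞-monoʳ-≤∞ x = +∞-mono-≤∞ (≤∞-refl {x})

NonNegative∞ : ℚ∞ → Set
NonNegative∞ x = fin 0ℚ ≤∞ x

x≤∞x+∞y : ∀ {x y} → NonNegative∞ y → x ≤∞ (x +∞ y)
x≤∞x+∞y {x} {y} 0≤y = subst (_≤∞ (x +∞ y)) (+∞-identityʳ x) (+∞-monoʳ-≤∞ x 0≤y)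

y≤∞x+∞y : ∀ {x y} → NonNegative∞ x → y ≤∞ (x +∞ y)
y≤∞x+∞y {x} {y} 0≤x = subst (_≤∞ (x +∞ y)) (+∞-identityˡ y) (+∞-mono-≤∞ 0≤x ≤∞-refl)

+∞-nonNegative : ∀ {x y} → NonNegative∞ x → NonNegative∞ y → NonNegative∞ (x +∞ y)
+∞-nonNegative 0≤x 0≤y = ≤∞-trans 0≤y (y≤∞x+∞y 0≤x)

if-nonNegative : ∀ b {x} → NonNegative∞ x → NonNegative∞ (if b then x else fin 0ℚ)
if-nonNegative true  0≤x = 0≤x
if-nonNegative false _   = ≤∞-refl

sumℚ-cong : ∀ n {f g : Fin n → ℚ} → (∀ j → f j ≡ g j) → sumℚ n f ≡ sumℚ n g
sumℚ-cong zero    f≗g = refl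
sumℚ-cong (suc n) f≗g = cong₂ _+_ (f≗g zero) (sumℚ-cong n (f≗g ∘ suc))

sumℚ-nonNegative : ∀ n {f : Fin n → ℚ} → (∀ j → 0ℚ ≤ f j) → 0ℚ ≤ sumℚ n f
sumℚ-nonNegative zero    0≤f = ℚ.≤-refl
sumℚ-nonNegative (suc n) {f} 0≤f =
  subst (_≤ sumℚ (suc n) f) (ℚ.+-identityˡ 0ℚ) (ℚ.+-mono-≤ (0≤f zero) (sumℚ-nonNegative n (0≤f ∘ suc)))

sumℚ∞-cong : ∀ n {f g : Fin n → ℚ∞} → (∀ j → f j ≡ g j) → sumℚ∞ n f ≡ sumℚ∞ n g
sumℚ∞-cong zero    f≗g = refl
sumℚ∞-cong (suc n) f≗g = cong₂ _+∞_ (f≗g zero) (sumℚ∞-cong n (f≗g ∘ suc))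

sumℚ∞-fin : ∀ n (f : Fin n → ℚ) → sumℚ∞ n (λ j → fin (f j)) ≡ fin (sumℚ n f)
sumℚ∞-fin zero    f = refl
sumℚ∞-fin (suc n) f = cong (fin (f zero) +∞_) (sumℚ∞-fin n (f ∘ suc))

sumℚ∞-nonNegative : ∀ n {f : Fin n → ℚ∞} → (∀ j → NonNegative∞ (f j)) → NonNegative∞ (sumℚ∞ n f)
sumℚ∞-nonNegative zero    0≤f = ≤∞-refl
sumℚ∞-nonNegative (suc n) 0≤f = +∞-nonNegative (0≤f zero) (sumℚ∞-nonNegative n (0≤f ∘ suc))

term≤∞sumℚ∞ : ∀ n {f : Fin n → ℚ∞} → (∀ j → NonNegative∞ (f j)) → ∀ j → f j ≤∞ sumℚ∞ n f
term≤∞sumℚ∞ (suc n) 0≤f zero    = x≤∞x+∞y (sumℚ∞-nonNegative n (0≤f ∘ suc))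
term≤∞sumℚ∞ (suc n) 0≤f (suc j) = ≤∞-trans (term≤∞sumℚ∞ n (0≤f ∘ suc) j) (y≤∞x+∞y (0≤f zero))

pair≤∞sumℚ∞ : ∀ n {f : Fin n → ℚ∞} → (∀ j → NonNegative∞ (f j)) →
              ∀ i j → i ≢ j → (f i +∞ f j) ≤∞ sumℚ∞ n f
pair≤∞sumℚ∞ (suc n) 0≤f zero    zero    i≢j = contradiction refl i≢j
pair≤∞sumℚ∞ (suc n) 0≤f zero    (suc j) i≢j = +∞-monoʳ-≤∞ _ (term≤∞sumℚ∞ n (0≤f ∘ suc) j)
pair≤∞sumℚ∞ (suc n) {f} 0≤f (suc i) zero i≢j =
  subst (_≤∞ sumℚ∞ (suc n) f) (+∞-comm (f zero) (f (suc i)))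
        (+∞-monoʳ-≤∞ _ (term≤∞sumℚ∞ n (0≤f ∘ suc) i))
pair≤∞sumℚ∞ (suc n) 0≤f (suc i) (suc j) i≢j =
  ≤∞-trans (pair≤∞sumℚ∞ n (0≤f ∘ suc) i j (i≢j ∘ cong suc)) (y≤∞x+∞y (0≤f zero))

sumℚ∞-↑ : ∀ n m (f : Fin (n +ℕ m) → ℚ∞) →
          sumℚ∞ (n +ℕ m) f ≡ sumℚ∞ n (λ j → f (j ↑ˡ m)) +∞ sumℚ∞ m (λ r → f (n ↑ʳ r))
sumℚ∞-↑ zero    m f = sym (+∞-identityˡ _)
sumℚ∞-↑ (suc n) m f =
  trans (cong (f zero +∞_) (sumℚ∞-↑ n m (f ∘ suc))) (sym (+∞-assoc (f zero) _ _))

sumℚ∞-zero : ∀ n → sumℚ∞ n (λ _ → fin 0ℚ) ≡ fin 0ℚ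
sumℚ∞-zero zero    = refl
sumℚ∞-zero (suc n) = trans (cong (fin 0ℚ +∞_) (sumℚ∞-zero n)) (+∞-identityˡ (fin 0ℚ))

sumℚ∞-δ : ∀ n (f : Fin n → ℚ∞) i → sumℚ∞ n (λ r → if does (r ≟ i) then f r else fin 0ℚ) ≡ f i
sumℚ∞-δ (suc n) f zero    = trans (cong (f zero +∞_) (sumℚ∞-zero n)) (+∞-identityʳ (f zero))
-- does (suc r ≟ suc i) computes to does (r ≟ i), so the summands shift by definition.
sumℚ∞-δ (suc n) f (suc i) = trans (+∞-identityˡ _) (sumℚ∞-δ n (f ∘ suc) i)

module ℕSum = CommutativeMonoidSum ℕ.+-0-commutativeMonoid

sumℕ≡sum : ∀ n (f : Fin n → ℕ) → sumℕ n f ≡ ℕSum.sum f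
sumℕ≡sum zero    f = refl
sumℕ≡sum (suc n) f = cong (f zero +ℕ_) (sumℕ≡sum n (f ∘ suc))

sumℕ-permute : ∀ {n} (f : Fin n → ℕ) (π : Permutation′ n) → sumℕ n f ≡ sumℕ n (λ r → f (π ⟨$⟩ʳ r))
sumℕ-permute {n} f π = begin
  sumℕ n f                        ≡⟨ sumℕ≡sum n f ⟩
  ℕSum.sum f                      ≡⟨ ℕSum.sum-permute f π ⟩
  ℕSum.sum (λ r → f (π ⟨$⟩ʳ r))   ≡⟨ sumℕ≡sum n _ ⟨
  sumℕ n (λ r → f (π ⟨$⟩ʳ r))     ∎
  where open ≡-Reasoning

sumℕ-mono-≤ : ∀ n {f g : Fin n → ℕ} → (∀ j → f j ≤ℕ g j) → sumℕ n f ≤ℕ sumℕ n g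
sumℕ-mono-≤ zero    f≤g = z≤n
sumℕ-mono-≤ (suc n) f≤g = ℕ.+-mono-≤ (f≤g zero) (sumℕ-mono-≤ n (f≤g ∘ suc))

sumℕ-tight : ∀ n {f g : Fin n → ℕ} → (∀ j → f j ≤ℕ g j) → sumℕ n g ≤ℕ sumℕ n f → ∀ j → f j ≡ g j
sumℕ-tight n f≤g Σg≤Σf j = ℕ.≤-antisym (f≤g j) (g≤f n f≤g Σg≤Σf j)
  where
  g≤f : ∀ n {f g : Fin n → ℕ} → (∀ j → f j ≤ℕ g j) → sumℕ n g ≤ℕ sumℕ n f → ∀ j → g j ≤ℕ f j
  g≤f (suc n) {f} {g} f≤g Σg≤Σf zero = ℕ.+-cancelʳ-≤ (sumℕ n (f ∘ suc)) (g zero) (f zero)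
    (ℕ.≤-trans (ℕ.+-monoʳ-≤ (g zero) (sumℕ-mono-≤ n (f≤g ∘ suc))) Σg≤Σf)
  g≤f (suc n) {f} {g} f≤g Σg≤Σf (suc j) = g≤f n (f≤g ∘ suc)
    (ℕ.+-cancelˡ-≤ (f zero) (sumℕ n (g ∘ suc)) (sumℕ n (f ∘ suc))
      (ℕ.≤-trans (ℕ.+-monoˡ-≤ (sumℕ n (g ∘ suc)) (f≤g zero)) Σg≤Σf)) j

sumℕ-suc : ∀ n (f : Fin n → ℕ) → sumℕ n (λ j → suc (f j)) ≡ n +ℕ sumℕ n f
sumℕ-suc zero    f = refl
sumℕ-suc (suc n) f = cong suc (trans (cong (f zero +ℕ_) (sumℕ-suc n (f ∘ suc)))
                                     (x∙yz≈y∙xz (f zero) n (sumℕ n (f ∘ suc))))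
  where open CommutativeSemigroupProperties ℕ.+-commutativeSemigroup using (x∙yz≈y∙xz)

triangular : ∀ n → (n * suc n) / 2 ≡ sumℕ n (λ j → suc (toℕ j))
triangular n = trans (cong (_/ 2) (sym (double n))) (m*n/n≡m (sumℕ n (λ j → suc (toℕ j))) 2)
  where
  open ≡-Reasoning
  double : ∀ n → sumℕ n (λ j → suc (toℕ j)) * 2 ≡ n * suc n
  double zero    = refl
  double (suc n) = begin
    suc (sumℕ n (λ j → suc (suc (toℕ j)))) * 2   ≡⟨ cong (λ s → suc s * 2) (sumℕ-suc n (λ j → suc (toℕ j))) ⟩
    (suc n +ℕ sumℕ n (λ j → suc (toℕ j))) * 2    ≡⟨ ℕ.*-distribʳ-+ 2 (suc n) _ ⟩
    suc n * 2 +ℕ sumℕ n (λ j → suc (toℕ j)) * 2  ≡⟨ cong (suc n * 2 +ℕ_) (double n) ⟩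
    suc n * 2 +ℕ n * suc n                       ≡⟨ cong (suc n * 2 +ℕ_) (ℕ.*-comm n (suc n)) ⟩
    suc n * 2 +ℕ suc n * n                       ≡⟨ ℕ.*-distribˡ-+ (suc n) 2 n ⟨
    suc n * suc (suc n)                          ∎

injective⇒surjective : ∀ {n} (f : Fin n → Fin n) → Injective _≡_ _≡_ f → ∀ i → ∃ λ r → f r ≡ i
injective⇒surjective {suc n} f f-injective i with any? (λ r → f r ≟ i)
... | yes hit  = hit
... | no  miss = contradiction (injective⇒≤ squeezed-injective) ℕ.1+n≰n
  where
  i≢f : ∀ r → i ≢ f r
  i≢f r i≡fr = miss (r , sym i≡fr)
  -- missing i, f squeezes Fin (suc n) injectively into Fin n
  squeezed-injective : Injective _≡_ _≡_ (λ r → punchOut (i≢f r))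
  squeezed-injective eq = f-injective (punchOut-injective (i≢f _) (i≢f _) eq)

injective⇒permutation : ∀ {n} (f : Fin n → Fin n) → Injective _≡_ _≡_ f → Permutation′ n
injective⇒permutation f f-injective =
  permutation f (proj₁ ∘ surj) (proj₂ ∘ surj) (λ r → f-injective (proj₂ (surj (f r))))
  where
  surj : ∀ i → ∃ λ r → f r ≡ i
  surj = injective⇒surjective f f-injective

machineLoad-nonNegative : ∀ c n {T : Fin c → Fin n → ℚ} → (∀ i j → 0ℚ ≤ T i j) →
                          ∀ S i → 0ℚ ≤ machineLoad c n T S i
machineLoad-nonNegative c n 0≤T S i =
  sumℚ-nonNegative n (λ j → if-nonNegativeℚ (does (S j ≟ i)) (0≤T i j))
  where
  if-nonNegativeℚ : ∀ b {x} → 0ℚ ≤ x → 0ℚ ≤ (if b then x else 0ℚ)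
  if-nonNegativeℚ true  0≤x = 0≤x
  if-nonNegativeℚ false _   = ℚ.≤-refl

machineLoad-cong : ∀ c n {T T′ : Fin c → Fin n → ℚ} {S S′ : Fin n → Fin c} i →
                   (∀ j → S j ≡ S′ j) → T i ≡ T′ i → machineLoad c n T S i ≡ machineLoad c n T′ S′ i
machineLoad-cong c n i S≗S′ Ti≡T′i =
  sumℚ-cong n (λ j → cong₂ (λ s t → if does (s ≟ i) then t j else 0ℚ) (S≗S′ j) Ti≡T′i)

machineLoad-permute : ∀ c n {T T′ : Fin c → Fin n → ℚ} (S : Fin n → Fin c) (π : Permutation′ c) r →
                      T′ (π ⟨$⟩ʳ r) ≡ T r →
                      machineLoad c n T (λ j → π ⟨$⟩ˡ S j) r ≡ machineLoad c n T′ S (π ⟨$⟩ʳ r)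
machineLoad-permute c n S π r T′πr≡Tr =
  sumℚ-cong n (λ j → cong₂ (λ b t → if b then t j else 0ℚ)
                           (does-⇔ (moved (S j)) (π ⟨$⟩ˡ S j ≟ r) (S j ≟ π ⟨$⟩ʳ r)) (sym T′πr≡Tr))
  where
  moved : ∀ i → (π ⟨$⟩ˡ i ≡ r) ⇔ (i ≡ π ⟨$⟩ʳ r)
  moved i = mk⇔ (λ eq → trans (sym (inverseʳ π)) (cong (π ⟨$⟩ʳ_) eq))
                (λ eq → trans (cong (π ⟨$⟩ˡ_) eq) (inverseˡ π))

clampFin-suc : ∀ k (r : Fin (suc k)) → clampFin k (suc (toℕ r)) ≡ r
clampFin-suc k r = toℕ-injective (trans (toℕ-fromℕ< _) (ℕ.m≥n⇒m⊓n≡n (toℕ≤pred[n] r)))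

module Reduction (k n : ℕ) (T : Fin (suc k) → Fin n → ℚ) (M δ : ℚ) where

  c : ℕ
  c = suc k

  L : Fin (n +ℕ c) → ℕ → ℚ∞
  L = reductionLoads k n T M δ

  B : ℚ
  B = (M + M) + δ

  cacheJobLoad : Fin c → ℕ → ℚ∞
  cacheJobLoad r x = if does (suc (toℕ r) ≤? x) then fin (M + δ) else ∞

  L-↑ˡ : ∀ j x → L (j ↑ˡ c) x ≡ fin (T (clampFin k x) j)
  L-↑ˡ j x rewrite splitAt-↑ˡ n j c = refl

  L-↑ʳ : ∀ r x → L (n ↑ʳ r) x ≡ cacheJobLoad r x
  L-↑ʳ r x rewrite splitAt-↑ʳ n c r = refl

  cacheJobLoad-≡ : ∀ r {x} → suc (toℕ r) ≤ℕ x → cacheJobLoad r x ≡ fin (M + δ)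
  cacheJobLoad-≡ r {x} r<x = if-cong (dec-true (suc (toℕ r) ≤? x) r<x)

  cacheJobLoad-needs-cache : ∀ r x {b} → cacheJobLoad r x ≤∞ fin b → suc (toℕ r) ≤ℕ x
  cacheJobLoad-needs-cache r x = finite (suc (toℕ r) ≤? x)
    where
    finite : ∀ {P : Set} {b} (P? : Dec P) → (if does P? then fin (M + δ) else ∞) ≤∞ fin b → P
    finite (yes p) _ = p
    finite (no  _) ()

  coreTimes : (Fin c → ℕ) → Fin c → Fin n → ℚ
  coreTimes p i = T (clampFin k (p i))

  cacheJobTerm : (Fin c → ℕ) → (Fin c → Fin c) → Fin c → Fin c → ℚ∞
  cacheJobTerm p f i r = if does (f r ≟ i) then cacheJobLoad r (p i) else fin 0ℚ

  cacheJobTerm-on : ∀ p f {i} r → f r ≡ i → cacheJobTerm p f i r ≡ cacheJobLoad r (p i)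
  cacheJobTerm-on p f {i} r fr≡i = if-cong (dec-true (f r ≟ i) fr≡i)

  cacheJobsLoad : (Fin c → ℕ) → (Fin c → Fin c) → Fin c → ℚ∞
  cacheJobsLoad p f i = sumℚ∞ c (cacheJobTerm p f i)

  coreLoad-split : ∀ p S i → coreLoad c (n +ℕ c) L p S i ≡
    fin (machineLoad c n (coreTimes p) (λ j → S (j ↑ˡ c)) i) +∞ cacheJobsLoad p (λ r → S (n ↑ʳ r)) i
  coreLoad-split p S i = trans (sumℚ∞-↑ n c _) (cong₂ _+∞_ originals cacheJobs)
    where
    selected : Fin (n +ℕ c) → Bool
    selected j = does (S j ≟ i)
    originals : sumℚ∞ n (λ j → if selected (j ↑ˡ c) then L (j ↑ˡ c) (p i) else fin 0ℚ)
              ≡ fin (machineLoad c n (coreTimes p) (λ j → S (j ↑ˡ c)) i)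
    originals = trans (sumℚ∞-cong n (λ j → trans (if-cong-then (selected (j ↑ˡ c)) (L-↑ˡ j (p i)))
                                                 (sym (if-float fin (selected (j ↑ˡ c))))))
                      (sumℚ∞-fin n _)
    cacheJobs : sumℚ∞ c (λ r → if selected (n ↑ʳ r) then L (n ↑ʳ r) (p i) else fin 0ℚ)
              ≡ cacheJobsLoad p (λ r → S (n ↑ʳ r)) i
    cacheJobs = sumℚ∞-cong c (λ r → if-cong-then (selected (n ↑ʳ r)) {y = fin 0ℚ} (L-↑ʳ r (p i)))

  K : ℕ
  K = (c * suc c) / 2

  fromSchedule : HasScheduleWithin c n T M → HasJointSolutionWithin c K (n +ℕ c) L B
  fromSchedule (schedule , schedule-ok) = p , S , ℕ.≤-reflexive (sym (triangular c)) , load-ok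
    where
    p : Fin c → ℕ
    p i = suc (toℕ i)

    S : Fin (n +ℕ c) → Fin c
    S j = [ schedule , id ] (splitAt n j)

    S-↑ˡ : ∀ j → S (j ↑ˡ c) ≡ schedule j
    S-↑ˡ j = cong [ schedule , id ] (splitAt-↑ˡ n j c)

    S-↑ʳ : ∀ r → S (n ↑ʳ r) ≡ r
    S-↑ʳ r = cong [ schedule , id ] (splitAt-↑ʳ n c r)

    originals : ∀ i → machineLoad c n (coreTimes p) (λ j → S (j ↑ˡ c)) i ≡ machineLoad c n T schedule i
    originals i = machineLoad-cong c n {T = coreTimes p} {T′ = T} i S-↑ˡ (cong T (clampFin-suc k i))

    cacheJobs : ∀ i → cacheJobsLoad p (λ r → S (n ↑ʳ r)) i ≡ fin (M + δ)
    cacheJobs i = begin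
      cacheJobsLoad p (λ r → S (n ↑ʳ r)) i
        ≡⟨ sumℚ∞-cong c diagonal ⟩
      sumℚ∞ c (λ r → if does (r ≟ i) then cacheJobLoad r (p i) else fin 0ℚ)
        ≡⟨ sumℚ∞-δ c (λ r → cacheJobLoad r (p i)) i ⟩
      cacheJobLoad i (p i)
        ≡⟨ cacheJobLoad-≡ i ℕ.≤-refl ⟩
      fin (M + δ) ∎
      where
      open ≡-Reasoning
      diagonal : ∀ r → cacheJobTerm p (λ r → S (n ↑ʳ r)) i r
                     ≡ (if does (r ≟ i) then cacheJobLoad r (p i) else fin 0ℚ)
      diagonal r = if-cong (cong (λ s → does (s ≟ i)) (S-↑ʳ r))

    load-ok : ∀ i → coreLoad c (n +ℕ c) L p S i ≤∞ fin B
    load-ok i rewrite coreLoad-split p S i | originals i | cacheJobs i =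
      fin≤fin (ℚ.≤-trans (ℚ.+-monoˡ-≤ (M + δ) (schedule-ok i)) (ℚ.≤-reflexive (sym (ℚ.+-assoc M M δ))))

  module FromSolution (M>0 : 0ℚ < M) (δ>0 : 0ℚ < δ) (0≤T : ∀ i j → 0ℚ ≤ T i j)
                      (p : Fin c → ℕ) (S : Fin (n +ℕ c) → Fin c) (cache-ok : sumℕ c p ≤ℕ K)
                      (load-ok : ∀ i → coreLoad c (n +ℕ c) L p S i ≤∞ fin B) where

    f : Fin c → Fin c
    f r = S (n ↑ʳ r)

    original : Fin c → ℚ
    original = machineLoad c n (coreTimes p) (λ j → S (j ↑ˡ c))

    split-load-ok : ∀ i → (fin (original i) +∞ cacheJobsLoad p f i) ≤∞ fin B
    split-load-ok i = subst (_≤∞ fin B) (coreLoad-split p S i) (load-ok i)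

    cacheJobs-ok : ∀ i → cacheJobsLoad p f i ≤∞ fin B
    cacheJobs-ok i =
      ≤∞-trans (y≤∞x+∞y (fin≤fin 0≤original)) (split-load-ok i)
      where
      0≤original : 0ℚ ≤ original i
      0≤original = machineLoad-nonNegative c n (λ i′ → 0≤T (clampFin k (p i′))) (λ j → S (j ↑ˡ c)) i

    cacheJobLoad-nonNegative : ∀ r x → NonNegative∞ (cacheJobLoad r x)
    cacheJobLoad-nonNegative r x = nonNegative (does (suc (toℕ r) ≤? x))
      where
      nonNegative : ∀ b → NonNegative∞ (if b then fin (M + δ) else ∞)
      nonNegative true  = fin≤fin (ℚ.<⇒≤ (subst (_< M + δ) (ℚ.+-identityˡ 0ℚ) (ℚ.+-mono-< M>0 δ>0)))
      nonNegative false = _ ≤∞∞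

    cacheJobTerm-nonNegative : ∀ i r → NonNegative∞ (cacheJobTerm p f i r)
    cacheJobTerm-nonNegative i r = if-nonNegative (does (f r ≟ i)) (cacheJobLoad-nonNegative r (p i))

    cacheJob≤cacheJobs : ∀ r → cacheJobLoad r (p (f r)) ≤∞ cacheJobsLoad p f (f r)
    cacheJob≤cacheJobs r =
      subst (_≤∞ cacheJobsLoad p f (f r)) (cacheJobTerm-on p f r refl)
            (term≤∞sumℚ∞ c (cacheJobTerm-nonNegative (f r)) r)

    enough-cache : ∀ r → suc (toℕ r) ≤ℕ p (f r)
    enough-cache r =
      cacheJobLoad-needs-cache r (p (f r)) (≤∞-trans (cacheJob≤cacheJobs r) (cacheJobs-ok (f r)))

    original-ok : ∀ r → original (f r) ≤ M
    original-ok r =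
      ℚ-+-cancelʳ-≤ (M + δ) (ℚ.≤-trans (fin≤fin⁻¹ core-ok) (ℚ.≤-reflexive (ℚ.+-assoc M M δ)))
      where
      core-ok : (fin (original (f r)) +∞ fin (M + δ)) ≤∞ fin B
      core-ok = ≤∞-trans (+∞-monoʳ-≤∞ _ cacheJob≤) (split-load-ok (f r))
        where
        cacheJob≤ : fin (M + δ) ≤∞ cacheJobsLoad p f (f r)
        cacheJob≤ = subst (_≤∞ cacheJobsLoad p f (f r)) (cacheJobLoad-≡ r (enough-cache r))
                          (cacheJob≤cacheJobs r)

    B<2[M+δ] : B < (M + δ) + (M + δ)
    B<2[M+δ] = subst₂ _<_ (ℚ.+-identityʳ B) (sym (regroup M δ)) (ℚ.+-monoʳ-< B δ>0)
      where
      open +-*-Solver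
      regroup : ∀ M δ → (M + δ) + (M + δ) ≡ ((M + M) + δ) + δ
      regroup = solve 2 (λ M δ → (M :+ δ) :+ (M :+ δ) := ((M :+ M) :+ δ) :+ δ) refl

    f-injective : Injective _≡_ _≡_ f
    f-injective {r₁} {r₂} fr₁≡fr₂ with r₁ ≟ r₂
    ... | yes r₁≡r₂ = r₁≡r₂
    ... | no  r₁≢r₂ =
      contradiction (ℚ.<-≤-trans B<2[M+δ] (fin≤fin⁻¹ (≤∞-trans two-cacheJobs (cacheJobs-ok (f r₁)))))
                    (ℚ.<-irrefl refl)
      where
      enough-cache₂ : suc (toℕ r₂) ≤ℕ p (f r₁)
      enough-cache₂ = subst (λ i → suc (toℕ r₂) ≤ℕ p i) (sym fr₁≡fr₂) (enough-cache r₂)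
      two-cacheJobs : (fin (M + δ) +∞ fin (M + δ)) ≤∞ cacheJobsLoad p f (f r₁)
      two-cacheJobs = subst₂ (λ x y → (x +∞ y) ≤∞ cacheJobsLoad p f (f r₁))
        (trans (cacheJobTerm-on p f r₁ refl) (cacheJobLoad-≡ r₁ (enough-cache r₁)))
        (trans (cacheJobTerm-on p f r₂ (sym fr₁≡fr₂)) (cacheJobLoad-≡ r₂ enough-cache₂))
        (pair≤∞sumℚ∞ c (cacheJobTerm-nonNegative (f r₁)) r₁ r₂ r₁≢r₂)

    π : Permutation′ c
    π = injective⇒permutation f f-injective

    exact-cache : ∀ r → p (f r) ≡ suc (toℕ r)
    exact-cache r = sym (sumℕ-tight c enough-cache cache-budget r)
      where
      open ℕ.≤-Reasoning
      cache-budget : sumℕ c (λ r → p (f r)) ≤ℕ sumℕ c (λ r → suc (toℕ r))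
      cache-budget = begin
        sumℕ c (λ r → p (f r))         ≡⟨ sumℕ-permute p π ⟨
        sumℕ c p                       ≤⟨ cache-ok ⟩
        K                              ≡⟨ triangular c ⟩
        sumℕ c (λ r → suc (toℕ r))     ∎

    schedule : Fin n → Fin c
    schedule j = π ⟨$⟩ˡ S (j ↑ˡ c)

    schedule-ok : ∀ r → machineLoad c n T schedule r ≤ M
    schedule-ok r =
      subst (_≤ M) (sym (machineLoad-permute c n {T = T} {T′ = coreTimes p} (λ j → S (j ↑ˡ c)) π r
                                             (cong T simulated)))
            (original-ok r)
      where
      simulated : clampFin k (p (f r)) ≡ r
      simulated = trans (cong (clampFin k) (exact-cache r)) (clampFin-suc k r)

lemma1 : (k n : ℕ) (T : Fin (suc k) → Fin n → ℚ) (M δ : ℚ) →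
    IsOrderedInstance (suc k) n T → 0ℚ < M → 0ℚ < δ →
    HasJointSolutionWithin (suc k) ((suc k * suc (suc k)) / 2) (n Data.Nat.+ suc k)
      (reductionLoads k n T M δ) ((M + M) + δ)
    ⇔ HasScheduleWithin (suc k) n T M
lemma1 k n T M δ (T>0 , _) M>0 δ>0 = mk⇔ toSchedule fromSchedule
  where
  open Reduction k n T M δ
  toSchedule : HasJointSolutionWithin c K (n +ℕ c) L B → HasScheduleWithin c n T M
  toSchedule (p , S , cache-ok , load-ok) = schedule , schedule-ok
    where open FromSolution M>0 δ>0 (λ i j → ℚ.<⇒≤ (T>0 i j)) p S cache-ok load-ok
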